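{- Let $q$ be an odd prime power, let $n$ be an even positive integer, and let $k$ be a divisor of $q-1$ with $k\ge 3$. Then $(q^n,k)$ does not give a $3$-design.
   Context: For a prime power $Q\equiv 1\pmod 4$ (note $q^n\equiv1\pmod 4$ here) and a divisor $k$ of $Q-1$, let $B$ be the unique subgroup of order $k$ of $\mathbb{F}_Q^\times$; $\mathrm{PSL}(2,Q)$ acts on $\mathrm{PG}(1,Q)=\mathbb{F}_Q\cup\{\infty\}$ by linear fractional transformations, and $(Q,k)$ gives a $3$-design if the $\mathrm{PSL}(2,Q)$-orbit $\{gB\}$ is the block set of a $3$-$(Q+1,k,\lambda)$ design for some positive integer $\lambda$. -}

module Defs where

open import Data.Nat using (ℕ; zero; suc; _<_)
open import Data.Fin using (Fin; zero; suc)
open import Data.Fin.Subset using (Subset; inside; outside; _∈_; ∣_∣; _⊆_)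
open import Data.Fin.Subset.Properties using (_⊆?_)
open import Data.Bool using (Bool; true; false; _∧_; if_then_else_)
open import Data.Vec using (Vec; _∷_; tabulate; lookup)
open import Data.Vec.Properties using (≡-dec)
open import Data.List as L using (List; length; filter; map; concatMap; allFin; deduplicate)
open import Data.Bool.ListAction using (any)
open import Data.Product using (_×_; _,_; ∃-syntax)
open import Data.Bool.Properties renaming (_≟_ to _≟B_)
open import Data.Fin.Properties using (_≟_)
open import Relation.Nullary using (¬_; Dec; yes; no)
open import Relation.Nullary.Decidable using (⌊_⌋)
open import Relation.Binary.PropositionalEquality using (_≡_; _≢_)
open import Algebra.Core using (Op₁; Op₂)
open import Algebra.Structures using (IsCommutativeRing)

-- A field structure whose underlying set is Fin Q (with propositional
-- equality).  Every finite field of order Q is isomorphic to one of these.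
record FieldOnFin (Q : ℕ) : Set where
  field
    _+_ _*_    : Op₂ (Fin Q)
    -_         : Op₁ (Fin Q)
    0# 1#      : Fin Q
    inv        : Fin Q → Fin Q
    isCommutativeRing : IsCommutativeRing _≡_ _+_ _*_ -_ 0# 1#
    0≢1        : 0# ≢ 1#
    inv-inverse : ∀ x → x ≢ 0# → inv x * x ≡ 1#

module _ {Q : ℕ} (F : FieldOnFin Q) where
  open FieldOnFin F

  IsMultSubgroupOfOrder : ℕ → Subset Q → Set
  IsMultSubgroupOfOrder k B =
    (¬ (0# ∈ B)) × (1# ∈ B) × (∀ x y → x ∈ B → y ∈ B → (x * y) ∈ B)
    × (∀ x → x ∈ B → inv x ∈ B) × ∣ B ∣ ≡ k

  -- PG(1,Q) = Fin (suc Q): zero is ∞, suc x is the field element x.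
  Point : Set
  Point = Fin (suc Q)

  Mat : Set
  Mat = Fin Q × Fin Q × Fin Q × Fin Q

  det : Mat → Fin Q
  det (a , b , c , d) = (a * d) + (- (b * c))

  -- all matrices of SL(2,Q); PSL(2,Q) acts through SL(2,Q)
  SL2 : List Mat
  SL2 = filter (λ m → det m ≟ 1#)
          (concatMap (λ a → concatMap (λ b → concatMap (λ c →
             map (λ d → (a , b , c , d)) (allFin Q)) (allFin Q)) (allFin Q)) (allFin Q))

  act : Mat → Point → Point
  act (a , b , c , d) zero = if ⌊ c ≟ 0# ⌋ then zero else suc (a * inv c)
  act (a , b , c , d) (suc x) =
    if ⌊ (c * x) + d ≟ 0# ⌋ then zero else suc (((a * x) + b) * inv ((c * x) + d))

  image : (Point → Point) → Subset (suc Q) → Subset (suc Q)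
  image f X = tabulate (λ y → any (λ x → lookup X x ∧ ⌊ f x ≟ y ⌋) (allFin (suc Q)))

  embed : Subset Q → Subset (suc Q)
  embed B = outside ∷ B

  blocks : Subset Q → List (Subset (suc Q))
  blocks B = deduplicate (≡-dec _≟B_) (map (λ g → image (act g) (embed B)) SL2)

  blocksThrough : Subset Q → Subset (suc Q) → ℕ
  blocksThrough B T = length (filter (λ X → T ⊆? X) (blocks B))

  -- (Q,k) gives a 3-design (with B the subgroup of order k): the orbit is the
  -- block set of a 3-(Q+1,k,λ) design for some positive λ.
  Gives3Design : Subset Q → Set
  Gives3Design B = ∃[ λ' ] (0 < λ') × (∀ (T : Subset (suc Q)) → ∣ T ∣ ≡ 3 → blocksThrough B T ≡ λ')

module Submission where

-- Write Q = q ^ n = 1 + 2m.  As n is even, q - 1 divides m, so x ↦ x ^ m is 1 on every nonzero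
-- square of F_Q and on F_q^×.  B lies in F_q (its elements have order dividing q - 1), and F_q,
-- the fixed field of the Frobenius x ↦ x ^ q, is closed under subtraction, so differences of
-- distinct elements of B are killed by x ↦ x ^ m as well.  If g = (a b ; c d) ∈ SL(2,Q) maps
-- b₁, b₂, b₃ ∈ B to ∞, 0, ν, then ν c² (b₃ - b₁) (b₂ - b₁) = b₃ - b₂, whence ν ^ m = 1.  Taking
-- for ν a non-square (ν ^ m ≠ 1; it exists because X ^ (m + 1) - X has at most m + 1 roots)
-- shows that no block contains {∞, 0, ν}, so λ would be 0.

open import Algebra.Bundles using (CommutativeRing)
open import Data.Nat.Base using (ℕ)
open import Defs

module Arithmetic where

  open import Data.Nat using (zero; suc; _+_; _*_; _^_; _∸_; _<_; _≤_; _!; s≤s; z≤n)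
  open import Data.Nat.Properties
    using (<⇒≱; <⇒≤; <-trans; ≤-trans; m≤m+n; m<m+n; <-irrefl; n<1+n; ∸-monoʳ-<; ^-*-assoc; *-comm
          ; m^n≡1⇒n≡0∨m≡1; _!*_!≢0)
  open import Data.Nat.Divisibility using (_∣_; _∤_; divides; _∣0; ∣⇒≤; ∣1⇒≡1; m∣m*n; n∣n; ∣m∣n⇒∣m+n)
  open import Data.Nat.DivMod using (m/n*n≡m)
  open import Data.Nat.Primality using (Prime; euclidsLemma; ¬prime[1])
  open import Data.Nat.Combinatorics using (_C_; nCk≡n!/k![n-k]!; k![n∸k]!∣n!)
  open import Data.Nat.Tactic.RingSolver using (solve)
  open import Data.Product using (_×_; _,_; ∃-syntax)
  open import Data.Sum using (inj₁; inj₂)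
  open import Data.List using ([]; _∷_)
  open import Function using (_∘′_)
  open import Relation.Nullary using (contradiction)
  open import Relation.Binary.PropositionalEquality using (_≡_; refl; sym; trans; cong; subst; module ≡-Reasoning)

  prime∤! : ∀ {p} → Prime p → ∀ m → m < p → p ∤ m !
  prime∤! {suc (suc _)} _ zero _ p∣1 with ∣1⇒≡1 p∣1
  ... | ()
  prime∤! p-prime (suc m) m<p p∣m! with euclidsLemma (suc m) (m !) p-prime p∣m!
  ... | inj₁ p∣1+m = <⇒≱ m<p (∣⇒≤ p∣1+m)
  ... | inj₂ p∣m!  = prime∤! p-prime m (<-trans (n<1+n m) m<p) p∣m!

  C*k!*[n∸k]!≡n! : ∀ {n k} → k ≤ n → (n C k) * (k ! * (n ∸ k) !) ≡ n !
  C*k!*[n∸k]!≡n! {n} {k} k≤n =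
    trans (cong (_* (k ! * (n ∸ k) !)) (nCk≡n!/k![n-k]! k≤n)) (m/n*n≡m (k![n∸k]!∣n! k≤n))
    where instance _ = k !* (n ∸ k) !≢0

  prime∣C : ∀ {p k} → Prime p → 0 < k → k < p → p ∣ p C k
  prime∣C {p@(suc p′)} {k} p-prime 0<k k<p
    with euclidsLemma (p C k) (k ! * (p ∸ k) !) p-prime
           (subst (p ∣_) (sym (C*k!*[n∸k]!≡n! (<⇒≤ k<p))) (m∣m*n (p′ !)))
  ... | inj₁ p∣C = p∣C
  ... | inj₂ p∣k!*[p∸k]! with euclidsLemma (k !) ((p ∸ k) !) p-prime p∣k!*[p∸k]!
  ...   | inj₁ p∣k!     = contradiction p∣k! (prime∤! p-prime k k<p)
  ...   | inj₂ p∣[p∸k]! = contradiction p∣[p∸k]! (prime∤! p-prime (p ∸ k) (∸-monoʳ-< 0<k (<⇒≤ k<p)))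

  2∤⇒odd : ∀ q → 2 ∤ q → ∃[ w ] q ≡ suc (2 * w)
  2∤⇒odd zero          2∤0   = contradiction (2 ∣0) 2∤0
  2∤⇒odd (suc zero)    _     = 0 , refl
  2∤⇒odd (suc (suc q)) 2∤2+q with 2∤⇒odd q (2∤2+q ∘′ ∣m∣n⇒∣m+n n∣n)
  ... | w , refl = suc w , solve (w ∷ [])

  odd-prime-power : ∀ {p r q} → Prime p → 0 < r → q ≡ p ^ r → 2 ∤ q → ∃[ w ] (q ≡ suc (2 * w) × 0 < w)
  odd-prime-power {p} {r} p-prime 0<r refl 2∤q with 2∤⇒odd (p ^ r) 2∤q
  ... | suc w , q≡1+2w = suc w , q≡1+2w , s≤s z≤n
  ... | zero  , pʳ≡1 with m^n≡1⇒n≡0∨m≡1 p r pʳ≡1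
  ...   | inj₁ refl = contradiction 0<r (<-irrefl refl)
  ...   | inj₂ refl = contradiction p-prime ¬prime[1]

  [1+s]^[1+t]≡1+s*[1+g] : ∀ s t → ∃[ g ] suc s ^ suc t ≡ suc (s * suc g)
  [1+s]^[1+t]≡1+s*[1+g] s zero = 0 , refl
  [1+s]^[1+t]≡1+s*[1+g] s (suc t) with [1+s]^[1+t]≡1+s*[1+g] s t
  ... | g , eq = suc s * suc g , (begin
    suc s * suc s ^ suc t          ≡⟨ cong (suc s *_) eq ⟩
    suc s * suc (s * suc g)        ≡⟨ solve (s ∷ g ∷ []) ⟩
    suc (s * suc (suc s * suc g))  ∎)
    where open ≡-Reasoning

  odd^even≡1+2m : ∀ w t → ∃[ j ] suc (2 * w) ^ (suc t * 2) ≡ suc (2 * (2 * w * suc j))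
  odd^even≡1+2m w t with [1+s]^[1+t]≡1+s*[1+g] (2 * (2 * w * suc w)) t
  ... | g , eq = g + w * suc g , (begin
    q ^ (suc t * 2)                          ≡⟨ cong (q ^_) (*-comm (suc t) 2) ⟩
    q ^ (2 * suc t)                          ≡⟨ ^-*-assoc q 2 (suc t) ⟨
    (q ^ 2) ^ suc t                          ≡⟨ cong (_^ suc t) (solve (w ∷ [])) ⟩
    suc (2 * (2 * w * suc w)) ^ suc t        ≡⟨ eq ⟩
    suc (2 * (2 * w * suc w) * suc g)        ≡⟨ solve (w ∷ g ∷ []) ⟩
    suc (2 * (2 * w * suc (g + w * suc g)))  ∎)
    where
    open ≡-Reasoning
    q = suc (2 * w)

  odd^even : ∀ {w n} → 0 < w → 0 < n → 2 ∣ n →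
             ∃[ m ] (suc (2 * w) ^ n ≡ suc (2 * m) × 2 * w ∣ m × 0 < m)
  odd^even _ () (divides zero refl)
  odd^even {suc w} _ _ (divides (suc t) refl) with odd^even≡1+2m (suc w) t
  ... | j , eq = 2 * suc w * suc j , eq , m∣m*n (suc j) , s≤s z≤n

  2+m≤1+2m : ∀ {m} → 0 < m → 2 + m ≤ 1 + 2 * m
  2+m≤1+2m {m} 0<m = s≤s (m<m+n m (≤-trans 0<m (m≤m+n m 0)))

module Frobenius {c ℓ} (R : CommutativeRing c ℓ) where

  open import Data.Nat as ℕ using (zero; suc; s≤s; z≤n)
  open import Data.Nat.Divisibility using (_∣_; divides)
  open import Data.Nat.Primality using (Prime)
  open import Data.Nat.Combinatorics using (_C_; nCn≡1)
  open import Data.Nat.Properties using (n∸n≡0)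
  open import Data.Fin using (zero; suc; fromℕ)
  open import Data.Fin.Properties using (toℕ-fromℕ; toℕ-inject₁; toℕ<n)
  open import Data.Vec.Functional using (init; tail)
  open import Relation.Binary.PropositionalEquality as ≡ using (_≡_)

  open CommutativeRing R hiding (zero)
  open import Algebra.Properties.Semiring.Exp semiring using (_^_; ^-assocʳ; ^-congˡ)
  open import Algebra.Properties.Semiring.Mult semiring using (_×_; ×-congʳ; ×-assoc-*; ×1-homo-*; ×-homo-1)
  open import Algebra.Properties.Monoid.Sum +-monoid using (sum; sum-init-last; sum-cong-≋; sum-replicate-zero)
  open import Algebra.Properties.CommutativeSemiring.Binomial commutativeSemiring using (theorem; binomialTerm)
  open import Relation.Binary.Reasoning.Setoid setoid
  open Arithmetic using (prime∣C)

  multiple×≈0 : ∀ {p n} → p × 1# ≈ 0# → p ∣ n → ∀ x → n × x ≈ 0#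
  multiple×≈0 {p} p×1≈0 (divides j ≡.refl) x = begin
    (j ℕ.* p) × x                  ≈⟨ ×-congʳ (j ℕ.* p) (*-identityˡ x) ⟨
    (j ℕ.* p) × (1# * x)           ≈⟨ ×-assoc-* (j ℕ.* p) 1# x ⟨
    ((j ℕ.* p) × 1#) * x           ≈⟨ *-congʳ (×1-homo-* j p) ⟩
    ((j × 1#) * (p × 1#)) * x      ≈⟨ *-congʳ (*-congˡ p×1≈0) ⟩
    ((j × 1#) * 0#) * x            ≈⟨ *-congʳ (zeroʳ _) ⟩
    0# * x                         ≈⟨ zeroˡ x ⟩
    0#                             ∎

  frobenius : ∀ {p} → Prime p → p × 1# ≈ 0# → ∀ x y → (x + y) ^ p ≈ x ^ p + y ^ p
  frobenius {p@(suc p₁@(suc _))} p-prime p×1≈0 x y = begin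
    (x + y) ^ p                                    ≈⟨ theorem p x y ⟩
    T zero + sum (tail T)                          ≈⟨ +-congˡ (sum-init-last (tail T)) ⟩
    T zero + (sum (init (tail T)) + T (fromℕ p))   ≈⟨ +-cong first-term (+-cong middle-terms last-term) ⟩
    y ^ p + (0# + x ^ p)                           ≈⟨ +-congˡ (+-identityˡ _) ⟩
    y ^ p + x ^ p                                  ≈⟨ +-comm _ _ ⟩
    x ^ p + y ^ p                                  ∎
    where
    T = binomialTerm x y p
    first-term : T zero ≈ y ^ p
    first-term = trans (×-homo-1 _) (*-identityˡ _)
    middle-terms : sum (init (tail T)) ≈ 0#
    middle-terms = trans (sum-cong-≋ vanishes) (sum-replicate-zero p₁)
      where
      vanishes : ∀ i → init (tail T) i ≈ 0#
      vanishes i = multiple×≈0 p×1≈0 (prime∣C p-prime (s≤s z≤n) (s≤s 0<k<p)) _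
        where 0<k<p = ≡.subst (ℕ._< p₁) (≡.sym (toℕ-inject₁ i)) (toℕ<n i)
    last-term : T (fromℕ p) ≈ x ^ p
    last-term = begin
      T (fromℕ p)                        ≡⟨ ≡.cong (λ k → (p C k) × (x ^ k * y ^ (p ℕ.∸ k))) (toℕ-fromℕ p) ⟩
      (p C p) × (x ^ p * y ^ (p ℕ.∸ p))  ≡⟨ ≡.cong₂ (λ c k → c × (x ^ p * y ^ k)) (nCn≡1 p) (n∸n≡0 p) ⟩
      1 × (x ^ p * 1#)                   ≈⟨ trans (×-homo-1 _) (*-identityʳ _) ⟩
      x ^ p                              ∎

  frobenius-^ : ∀ {p} → Prime p → p × 1# ≈ 0# → ∀ r x y →
                (x + y) ^ (p ℕ.^ r) ≈ x ^ (p ℕ.^ r) + y ^ (p ℕ.^ r)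
  frobenius-^ _ _ zero x y = trans (*-identityʳ _) (+-cong (sym (*-identityʳ x)) (sym (*-identityʳ y)))
  frobenius-^ {p} p-prime p×1≈0 (suc r) x y = begin
    (x + y) ^ (p ℕ.* p ℕ.^ r)                   ≈⟨ ^-assocʳ (x + y) p (p ℕ.^ r) ⟨
    ((x + y) ^ p) ^ (p ℕ.^ r)                   ≈⟨ ^-congˡ (p ℕ.^ r) (frobenius p-prime p×1≈0 x y) ⟩
    (x ^ p + y ^ p) ^ (p ℕ.^ r)                 ≈⟨ frobenius-^ p-prime p×1≈0 r (x ^ p) (y ^ p) ⟩
    (x ^ p) ^ (p ℕ.^ r) + (y ^ p) ^ (p ℕ.^ r)   ≈⟨ +-cong (^-assocʳ x p _) (^-assocʳ y p _) ⟩
    x ^ (p ℕ.* p ℕ.^ r) + y ^ (p ℕ.* p ℕ.^ r)   ∎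

-- The ring solver decides equalities by normalising coefficients, which needs a coefficient
-- ring with computable equality: ℤ, mapped into R by n ↦ n × 1#.
module IntegerCoefficients {c ℓ} (R : CommutativeRing c ℓ) where

  open import Data.Integer as ℤ using (ℤ; +_; -[1+_])
  import Data.Integer.Properties as ℤₚ
  open import Data.Nat as ℕ using (zero; suc)
  import Data.Nat.Properties as ℕₚ
  open import Data.Maybe using (Maybe; map)
  open import Relation.Nullary.Decidable using (dec⇒maybe)
  import Relation.Binary.PropositionalEquality as ≡

  open CommutativeRing R
  open import Algebra.Properties.Ring ring using (-0#≈0#; -‿involutive; -‿+-comm; -‿distribˡ-*)
  open import Algebra.Properties.CommutativeSemigroup +-commutativeSemigroup using (interchange)
  open import Algebra.Properties.Semiring.Mult semiring using (_×_; ×-homo-+)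
  open import Algebra.Solver.Ring.AlmostCommutativeRing using (fromCommutativeRing; _-Raw-AlmostCommutative⟶_)
  open import Relation.Binary.Reasoning.Setoid setoid

  ⟦_⟧ : ℤ → Carrier
  ⟦ + n ⟧      = n × 1#
  ⟦ -[1+ n ] ⟧ = - (suc n × 1#)

  ⟦-⟧ : ∀ i → ⟦ ℤ.- i ⟧ ≈ - ⟦ i ⟧
  ⟦-⟧ (+ zero)   = sym -0#≈0#
  ⟦-⟧ (+ suc n)  = refl
  ⟦-⟧ -[1+ n ]   = sym (-‿involutive _)

  ⟦⊖⟧ : ∀ m n → ⟦ m ℤ.⊖ n ⟧ ≈ m × 1# - n × 1#
  ⟦⊖⟧ zero    zero    = sym (trans (+-identityˡ _) -0#≈0#)
  ⟦⊖⟧ zero    (suc n) = sym (+-identityˡ _)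
  ⟦⊖⟧ (suc m) zero    = sym (trans (+-congˡ -0#≈0#) (+-identityʳ _))
  ⟦⊖⟧ (suc m) (suc n) = begin
    ⟦ suc m ℤ.⊖ suc n ⟧               ≡⟨ ≡.cong ⟦_⟧ (ℤₚ.[1+m]⊖[1+n]≡m⊖n m n) ⟩
    ⟦ m ℤ.⊖ n ⟧                       ≈⟨ ⟦⊖⟧ m n ⟩
    m × 1# - n × 1#                   ≈⟨ +-identityˡ _ ⟨
    0# + (m × 1# - n × 1#)            ≈⟨ +-congʳ (-‿inverseʳ 1#) ⟨
    (1# - 1#) + (m × 1# - n × 1#)     ≈⟨ interchange _ _ _ _ ⟩
    (1# + m × 1#) + (- 1# - n × 1#)   ≈⟨ +-congˡ (-‿+-comm _ _) ⟩
    suc m × 1# - suc n × 1#           ∎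

  ⟦+⟧ : ∀ i j → ⟦ i ℤ.+ j ⟧ ≈ ⟦ i ⟧ + ⟦ j ⟧
  ⟦+⟧ (+ m)     (+ n)     = ×-homo-+ 1# m n
  ⟦+⟧ (+ m)     -[1+ n ]  = ⟦⊖⟧ m (suc n)
  ⟦+⟧ -[1+ m ]  (+ n)     = trans (⟦⊖⟧ n (suc m)) (+-comm _ _)
  ⟦+⟧ -[1+ m ]  -[1+ n ]  = begin
    - (suc (suc (m ℕ.+ n)) × 1#)      ≡⟨ ≡.cong (λ k → - (suc k × 1#)) (ℕₚ.+-suc m n) ⟨
    - ((suc m ℕ.+ suc n) × 1#)        ≈⟨ -‿cong (×-homo-+ 1# (suc m) (suc n)) ⟩
    - (suc m × 1# + suc n × 1#)       ≈⟨ -‿+-comm _ _ ⟨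
    - (suc m × 1#) - suc n × 1#       ∎

  ⟦+*⟧ : ∀ m j → ⟦ + m ℤ.* j ⟧ ≈ m × 1# * ⟦ j ⟧
  ⟦+*⟧ zero    j = sym (zeroˡ _)
  ⟦+*⟧ (suc m) j = begin
    ⟦ + suc m ℤ.* j ⟧                 ≡⟨ ≡.cong ⟦_⟧ (ℤₚ.suc-* (+ m) j) ⟩
    ⟦ j ℤ.+ + m ℤ.* j ⟧               ≈⟨ ⟦+⟧ j _ ⟩
    ⟦ j ⟧ + ⟦ + m ℤ.* j ⟧             ≈⟨ +-cong (sym (*-identityˡ _)) (⟦+*⟧ m j) ⟩
    1# * ⟦ j ⟧ + m × 1# * ⟦ j ⟧       ≈⟨ distribʳ _ _ _ ⟨
    suc m × 1# * ⟦ j ⟧                ∎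

  ⟦*⟧ : ∀ i j → ⟦ i ℤ.* j ⟧ ≈ ⟦ i ⟧ * ⟦ j ⟧
  ⟦*⟧ (+ m)    j = ⟦+*⟧ m j
  ⟦*⟧ -[1+ m ] j = begin
    ⟦ -[1+ m ] ℤ.* j ⟧                ≡⟨ ≡.cong ⟦_⟧ (ℤₚ.neg-distribˡ-* (+ suc m) j) ⟨
    ⟦ ℤ.- (+ suc m ℤ.* j) ⟧           ≈⟨ ⟦-⟧ (+ suc m ℤ.* j) ⟩
    - ⟦ + suc m ℤ.* j ⟧               ≈⟨ -‿cong (⟦+*⟧ (suc m) j) ⟩
    - (suc m × 1# * ⟦ j ⟧)            ≈⟨ -‿distribˡ-* _ _ ⟩
    - (suc m × 1#) * ⟦ j ⟧            ∎

  homomorphism : CommutativeRing.rawRing ℤₚ.+-*-commutativeRing -Raw-AlmostCommutative⟶ fromCommutativeRing R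
  homomorphism = record
    { ⟦_⟧ = ⟦_⟧ ; +-homo = ⟦+⟧ ; *-homo = ⟦*⟧ ; -‿homo = ⟦-⟧ ; 0-homo = refl ; 1-homo = +-identityʳ 1# }

  ⟦⟧-≟ : ∀ i j → Maybe (⟦ i ⟧ ≈ ⟦ j ⟧)
  ⟦⟧-≟ i j = map (λ { ≡.refl → refl }) (dec⇒maybe (i ℤ.≟ j))

  open import Algebra.Solver.Ring _ (fromCommutativeRing R) homomorphism ⟦⟧-≟ public
    using (solve; _:=_; _:+_; _:*_; _:-_)

module FiniteField {Q : ℕ} (F : FieldOnFin Q) where

  open import Data.Nat as ℕ using (_∸_)
  import Data.Nat.Properties as ℕₚ
  open import Data.Nat.Divisibility using (_∣_; divides)
  open import Data.Nat.Primality using (Prime)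
  open import Data.Bool using (if_then_else_)
  open import Data.Fin using (Fin; zero; suc)
  open import Data.Fin.Properties using (_≟_)
  open import Data.Fin.Permutation using (Permutation; permutation)
  open import Data.Fin.Subset using (Subset; inside; outside; _∈_; ∣_∣; ∁; ⁅_⁆)
  open import Data.Fin.Subset.Properties
    using (_∈?_; x∉⁅y⁆⇒x≢y; x≢y⇒x∉⁅y⁆; x∈∁p⇒x∉p; x∉p⇒x∈∁p; ∣∁p∣≡n∸∣p∣; ∣⁅x⁆∣≡1)
  open import Data.Vec using ([]; _∷_)
  open import Data.Product using (_,_)
  open import Data.Sum using (_⊎_; inj₁; inj₂)
  open import Function using (_∘_; id)
  open import Level using (0ℓ)
  open import Relation.Nullary using (yes; no; does; contradiction)
  open import Relation.Binary.PropositionalEquality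
  open FieldOnFin F using (isCommutativeRing; 0≢1)
  open FieldOnFin F public using (inv; inv-inverse)

  commutativeRing : CommutativeRing 0ℓ 0ℓ
  commutativeRing = record { isCommutativeRing = isCommutativeRing }

  open CommutativeRing commutativeRing public
    using ( _+_; _*_; -_; _-_; 0#; 1#; +-identityˡ; +-identityʳ; -‿inverseˡ; -‿inverseʳ
          ; *-identityˡ; *-identityʳ; *-assoc; *-comm; zeroˡ; zeroʳ)
  open CommutativeRing commutativeRing
    using (ring; semiring; commutativeSemiring; +-group; +-commutativeMonoid; *-commutativeMonoid; *-commutativeSemigroup)
  open import Algebra.Properties.Semiring.Exp semiring public using (_^_)
  open import Algebra.Properties.Semiring.Exp semiring using (^-assocʳ)
  open import Algebra.Properties.CommutativeSemiring.Exp commutativeSemiring using (^-distrib-*)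
  open import Algebra.Properties.Group +-group
    using (x∙y⁻¹≈ε⇒x≈y; inverseʳ-unique; ⁻¹-injective; ε⁻¹≈ε; //-rightDividesˡ; //-rightDividesʳ)
  open import Algebra.Properties.Ring ring using (+-cancelˡ)
  open import Algebra.Properties.CommutativeSemigroup *-commutativeSemigroup using (x∙yz≈y∙xz)
  open import Algebra.Properties.Semiring.Mult semiring using (_×_; ×1-homo-*)
  import Algebra.Properties.CommutativeMonoid.Sum
  module Sum = Algebra.Properties.CommutativeMonoid.Sum +-commutativeMonoid
  module Product = Algebra.Properties.CommutativeMonoid.Sum *-commutativeMonoid
  open ≡-Reasoning

  1≢0 : 1# ≢ 0#
  1≢0 1≡0 = 0≢1 (sym 1≡0)

  inv-*-cancelˡ : ∀ {x y} → x ≢ 0# → inv x * (x * y) ≡ y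
  inv-*-cancelˡ {x} {y} x≢0 = begin
    inv x * (x * y)  ≡⟨ *-assoc _ _ _ ⟨
    inv x * x * y    ≡⟨ cong (_* y) (inv-inverse x x≢0) ⟩
    1# * y           ≡⟨ *-identityˡ y ⟩
    y                ∎

  *-inv-cancelˡ : ∀ {x y} → x ≢ 0# → x * (inv x * y) ≡ y
  *-inv-cancelˡ {x} {y} x≢0 = trans (x∙yz≈y∙xz x (inv x) y) (inv-*-cancelˡ x≢0)

  *-cancelˡ : ∀ {x y z} → x ≢ 0# → x * y ≡ x * z → y ≡ z
  *-cancelˡ {x} {y} {z} x≢0 xy≡xz = begin
    y                ≡⟨ inv-*-cancelˡ x≢0 ⟨
    inv x * (x * y)  ≡⟨ cong (inv x *_) xy≡xz ⟩
    inv x * (x * z)  ≡⟨ inv-*-cancelˡ x≢0 ⟩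
    z                ∎

  x*y≡0⇒x≡0⊎y≡0 : ∀ {x y} → x * y ≡ 0# → x ≡ 0# ⊎ y ≡ 0#
  x*y≡0⇒x≡0⊎y≡0 {x} {y} xy≡0 with x ≟ 0#
  ... | yes x≡0 = inj₁ x≡0
  ... | no  x≢0 = inj₂ (*-cancelˡ x≢0 (trans xy≡0 (sym (zeroʳ x))))

  x*y≢0 : ∀ {x y} → x ≢ 0# → y ≢ 0# → x * y ≢ 0#
  x*y≢0 x≢0 y≢0 xy≡0 with x*y≡0⇒x≡0⊎y≡0 xy≡0
  ... | inj₁ x≡0 = x≢0 x≡0
  ... | inj₂ y≡0 = y≢0 y≡0

  x≢y⇒x-y≢0 : ∀ {x y} → x ≢ y → x - y ≢ 0#
  x≢y⇒x-y≢0 x≢y x-y≡0 = x≢y (x∙y⁻¹≈ε⇒x≈y _ _ x-y≡0)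

  -x≢0 : ∀ {x} → x ≢ 0# → - x ≢ 0#
  -x≢0 x≢0 -x≡0 = x≢0 (⁻¹-injective (trans -x≡0 (sym ε⁻¹≈ε)))

  1^n≡1 : ∀ n → 1# ^ n ≡ 1#
  1^n≡1 ℕ.zero    = refl
  1^n≡1 (ℕ.suc n) = trans (*-identityˡ _) (1^n≡1 n)

  ^≡1-∣ : ∀ {x k m} → x ^ k ≡ 1# → k ∣ m → x ^ m ≡ 1#
  ^≡1-∣ {x} {k} x^k≡1 (divides j refl) = begin
    x ^ (j ℕ.* k)  ≡⟨ cong (x ^_) (ℕₚ.*-comm j k) ⟩
    x ^ (k ℕ.* j)  ≡⟨ ^-assocʳ x k j ⟨
    (x ^ k) ^ j    ≡⟨ cong (_^ j) x^k≡1 ⟩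
    1# ^ j         ≡⟨ 1^n≡1 j ⟩
    1#             ∎

  *-^≡1 : ∀ {x y} m → y ^ m ≡ 1# → (x * y) ^ m ≡ x ^ m
  *-^≡1 {x} {y} m y^m≡1 = begin
    (x * y) ^ m    ≡⟨ ^-distrib-* x y m ⟩
    x ^ m * y ^ m  ≡⟨ cong (x ^ m *_) y^m≡1 ⟩
    x ^ m * 1#     ≡⟨ *-identityʳ _ ⟩
    x ^ m          ∎

  scaling : ∀ {b} → b ≢ 0# → Permutation Q Q
  scaling {b} b≢0 = permutation (b *_) (inv b *_) (λ _ → *-inv-cancelˡ b≢0) (λ _ → inv-*-cancelˡ b≢0)

  ∏ : ∀ {n} → (Fin n → Fin Q) → Fin Q
  ∏ = Product.sum

  ∏≢0 : ∀ {n} (f : Fin n → Fin Q) → (∀ i → f i ≢ 0#) → ∏ f ≢ 0#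
  ∏≢0 {ℕ.zero}  f f≢0 = 1≢0
  ∏≢0 {ℕ.suc n} f f≢0 = x*y≢0 (f≢0 zero) (∏≢0 (f ∘ suc) (f≢0 ∘ suc))

  ∏-indicator : ∀ {n} (S : Subset n) b → ∏ (λ i → if does (i ∈? S) then b else 1#) ≡ b ^ ∣ S ∣
  ∏-indicator []            b = refl
  ∏-indicator (inside  ∷ S) b = cong (b *_) (∏-indicator S b)
  ∏-indicator (outside ∷ S) b = trans (*-identityˡ _) (∏-indicator S b)

  b^∣S∣≡1 : ∀ {b} (S : Subset Q) → (∀ {x} → x ∈ S → x ≢ 0#) → b ≢ 0# →
            (∀ {x} → x ∈ S → b * x ∈ S) → (∀ {x} → b * x ∈ S → x ∈ S) → b ^ ∣ S ∣ ≡ 1#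
  b^∣S∣≡1 {b} S S⊆F× b≢0 bS⊆S b⁻¹S⊆S = sym (*-cancelˡ (∏≢0 χ χ≢0) (begin
    ∏ χ * 1#                ≡⟨ *-identityʳ _ ⟩
    ∏ χ                     ≡⟨ Product.∑-permute χ (scaling b≢0) ⟩
    ∏ (λ x → χ (b * x))     ≡⟨ Product.sum-cong-≗ χ-scaled ⟩
    ∏ (λ x → β x * χ x)     ≡⟨ Product.∑-distrib-+ β χ ⟩
    ∏ β * ∏ χ               ≡⟨ cong (_* ∏ χ) (∏-indicator S b) ⟩
    b ^ ∣ S ∣ * ∏ χ         ≡⟨ *-comm _ _ ⟩
    ∏ χ * b ^ ∣ S ∣         ∎))
    where
    χ β : Fin Q → Fin Q
    χ x = if does (x ∈? S) then x else 1#
    β x = if does (x ∈? S) then b else 1#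
    χ≢0 : ∀ x → χ x ≢ 0#
    χ≢0 x with x ∈? S
    ... | yes x∈S = S⊆F× x∈S
    ... | no  _   = 1≢0
    χ-scaled : ∀ x → χ (b * x) ≡ β x * χ x
    χ-scaled x with x ∈? S | (b * x) ∈? S
    ... | yes _   | yes _    = refl
    ... | no  _   | no  _    = sym (*-identityˡ 1#)
    ... | yes x∈S | no  bx∉S = contradiction (bS⊆S x∈S) bx∉S
    ... | no  x∉S | yes bx∈S = contradiction (b⁻¹S⊆S bx∈S) x∉S

  fermat : ∀ {c} → c ≢ 0# → c ^ (Q ∸ 1) ≡ 1#
  fermat {c} c≢0 = subst (λ e → c ^ e ≡ 1#) ∣F×∣≡Q∸1 (b^∣S∣≡1 F× ∈F×⇒≢0 c≢0
    (λ x∈F× → ≢0⇒∈F× (x*y≢0 c≢0 (∈F×⇒≢0 x∈F×)))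
    (λ cx∈F× → ≢0⇒∈F× (λ x≡0 → ∈F×⇒≢0 cx∈F× (trans (cong (c *_) x≡0) (zeroʳ c)))))
    where
    F× : Subset Q
    F× = ∁ ⁅ 0# ⁆
    ∈F×⇒≢0 : ∀ {x} → x ∈ F× → x ≢ 0#
    ∈F×⇒≢0 = x∉⁅y⁆⇒x≢y ∘ x∈∁p⇒x∉p
    ≢0⇒∈F× : ∀ {x} → x ≢ 0# → x ∈ F×
    ≢0⇒∈F× = x∉p⇒x∈∁p ∘ x≢y⇒x∉⁅y⁆
    ∣F×∣≡Q∸1 : ∣ F× ∣ ≡ Q ∸ 1
    ∣F×∣≡Q∸1 = trans (∣∁p∣≡n∸∣p∣ ⁅ 0# ⁆) (cong (Q ∸_) (∣⁅x⁆∣≡1 0#))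

  subgroup-^≡1 : ∀ {k B b} → IsMultSubgroupOfOrder F k B → b ∈ B → b ^ k ≡ 1#
  subgroup-^≡1 {B = B} {b} (0∉B , _ , *-closed , inv-closed , ∣B∣≡k) b∈B =
    subst (λ e → b ^ e ≡ 1#) ∣B∣≡k (b^∣S∣≡1 B B⊆F× b≢0 (*-closed _ _ b∈B)
      (λ bx∈B → subst (_∈ B) (inv-*-cancelˡ b≢0) (*-closed _ _ (inv-closed b b∈B) bx∈B)))
    where
    B⊆F× : ∀ {x} → x ∈ B → x ≢ 0#
    B⊆F× x∈B x≡0 = 0∉B (subst (_∈ B) x≡0 x∈B)
    b≢0 = B⊆F× b∈B

  squares-^≡1 : ∀ {m c} → Q ≡ ℕ.suc (2 ℕ.* m) → c ≢ 0# → (c * c) ^ m ≡ 1#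
  squares-^≡1 {m} {c} Q≡1+2m c≢0 = begin
    (c * c) ^ m     ≡⟨ cong (λ z → (c * z) ^ m) (*-identityʳ c) ⟨
    (c ^ 2) ^ m     ≡⟨ ^-assocʳ c 2 m ⟩
    c ^ (2 ℕ.* m)   ≡⟨ cong (λ n → c ^ (n ∸ 1)) Q≡1+2m ⟨
    c ^ (Q ∸ 1)     ≡⟨ fermat c≢0 ⟩
    1#              ∎

  translation : Permutation Q Q
  translation = permutation (_+ 1#) (_- 1#) (//-rightDividesˡ 1#) (//-rightDividesʳ 1#)

  Q×1≡0 : Q × 1# ≡ 0#
  Q×1≡0 = +-cancelˡ Σ (Q × 1#) 0# (begin
    Σ + Q × 1#                ≡⟨ cong (Σ +_) (Sum.sum-replicate Q) ⟨
    Σ + Sum.sum {Q} (λ _ → 1#) ≡⟨ Sum.∑-distrib-+ id (λ _ → 1#) ⟨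
    Sum.sum {Q} (λ x → x + 1#) ≡⟨ Sum.∑-permute id translation ⟨
    Σ                         ≡⟨ +-identityʳ Σ ⟨
    Σ + 0#                    ∎)
    where Σ = Sum.sum id

  pᵉ×1≡0⇒p×1≡0 : ∀ {p} e → (p ℕ.^ e) × 1# ≡ 0# → p × 1# ≡ 0#
  pᵉ×1≡0⇒p×1≡0     ℕ.zero    1≡0    = contradiction (trans (sym (+-identityʳ 1#)) 1≡0) 1≢0
  pᵉ×1≡0⇒p×1≡0 {p} (ℕ.suc e) pᵉ⁺¹≡0
    with x*y≡0⇒x≡0⊎y≡0 (trans (sym (×1-homo-* p (p ℕ.^ e))) pᵉ⁺¹≡0)
  ... | inj₁ p×1≡0 = p×1≡0
  ... | inj₂ pᵉ×1≡0 = pᵉ×1≡0⇒p×1≡0 e pᵉ×1≡0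

  frobenius-pʳ : ∀ {p e} → Prime p → Q ≡ p ℕ.^ e → ∀ r x y →
                 (x + y) ^ (p ℕ.^ r) ≡ x ^ (p ℕ.^ r) + y ^ (p ℕ.^ r)
  frobenius-pʳ {e = e} p-prime Q≡pᵉ = Frobenius.frobenius-^ commutativeRing p-prime
    (pᵉ×1≡0⇒p×1≡0 e (subst (λ n → n × 1# ≡ 0#) Q≡pᵉ Q×1≡0))

  differences-^≡1 : ∀ {e x y} → (∀ u v → (u + v) ^ ℕ.suc e ≡ u ^ ℕ.suc e + v ^ ℕ.suc e) →
                    x ^ e ≡ 1# → y ^ e ≡ 1# → x ≢ y → (x - y) ^ e ≡ 1#
  differences-^≡1 {e} {x} {y} additive x^e≡1 y^e≡1 x≢y = *-cancelˡ (x≢y⇒x-y≢0 x≢y) (begin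
    (x - y) ^ ℕ.suc e             ≡⟨ additive x (- y) ⟩
    x ^ ℕ.suc e + (- y) ^ ℕ.suc e ≡⟨ cong₂ _+_ (fixed x^e≡1) -y-fixed ⟩
    x - y                         ≡⟨ *-identityʳ _ ⟨
    (x - y) * 1#                  ∎)
    where
    fixed : ∀ {u} → u ^ e ≡ 1# → u ^ ℕ.suc e ≡ u
    fixed {u} u^e≡1 = trans (cong (u *_) u^e≡1) (*-identityʳ u)
    -y-fixed : (- y) ^ ℕ.suc e ≡ - y
    -y-fixed = trans (inverseʳ-unique (y ^ ℕ.suc e) _ (begin
      y ^ ℕ.suc e + (- y) ^ ℕ.suc e  ≡⟨ additive y (- y) ⟨
      (y - y) ^ ℕ.suc e              ≡⟨ cong (_^ ℕ.suc e) (-‿inverseʳ y) ⟩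
      0# ^ ℕ.suc e                   ≡⟨ zeroˡ _ ⟩
      0#                             ∎)) (cong -_ (fixed y^e≡1))

  differences-in-subfield : ∀ {p e r s k m B} → Prime p → Q ≡ p ℕ.^ e → ℕ.suc s ≡ p ℕ.^ r →
                            IsMultSubgroupOfOrder F k B → k ∣ s → s ∣ m →
                            ∀ {x y} → x ∈ B → y ∈ B → x ≢ y → (x - y) ^ m ≡ 1#
  differences-in-subfield {e = e} {r} {s} p-prime Q≡pᵉ 1+s≡pʳ B≤F× k∣s s∣m x∈B y∈B x≢y =
    ^≡1-∣ (differences-^≡1 {s} additive (^≡1-∣ (subgroup-^≡1 B≤F× x∈B) k∣s)
                                        (^≡1-∣ (subgroup-^≡1 B≤F× y∈B) k∣s) x≢y) s∣m
    where
    additive : ∀ u v → (u + v) ^ ℕ.suc s ≡ u ^ ℕ.suc s + v ^ ℕ.suc s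
    additive = subst (λ n → ∀ u v → (u + v) ^ n ≡ u ^ n + v ^ n) (sym 1+s≡pʳ)
                     (frobenius-pʳ {e = e} p-prime Q≡pᵉ r)

module Polynomials {Q : ℕ} (F : FieldOnFin Q) where

  open import Data.Nat as ℕ using (zero; suc; _<_; s≤s; z≤n)
  open import Data.Nat.Properties using (<⇒≱)
  open import Data.Fin using (Fin)
  open import Data.Fin.Properties using (_≟_; ¬∀⟶∃¬)
  open import Data.List using (List; []; _∷_; length)
  open import Data.List.Properties using (length-tabulate)
  open import Data.List.Relation.Unary.All as All using (All; []; _∷_)
  open import Data.List.Relation.Unary.Unique.Propositional using (Unique)
  open import Data.List.Relation.Unary.AllPairs using (_∷_)
  open import Data.List.Relation.Unary.Unique.Propositional.Properties using (allFin⁺)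
  open import Data.Product using (_×_; _,_; ∃-syntax)
  open import Data.Sum using (_⊎_; inj₁; inj₂)
  open import Function using (_∘_; id)
  open import Relation.Nullary using (¬_; contradiction)
  open import Relation.Nullary.Decidable using (_⊎-dec_)
  open import Relation.Binary.PropositionalEquality
  open FiniteField F
  open IntegerCoefficients commutativeRing using (solve; _:=_; _:+_; _:*_; _:-_)
  open ≡-Reasoning

  eval : List (Fin Q) → Fin Q → Fin Q
  eval []       x = 0#
  eval (c ∷ cs) x = c + x * eval cs x

  _÷[X-_] : List (Fin Q) → Fin Q → List (Fin Q)
  []           ÷[X- a ] = []
  (c ∷ [])     ÷[X- a ] = []
  (c ∷ d ∷ ds) ÷[X- a ] = eval (d ∷ ds) a ∷ (d ∷ ds) ÷[X- a ]

  eval-÷ : ∀ f a x → eval f x ≡ (x - a) * eval (f ÷[X- a ]) x + eval f a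
  eval-÷ []           a x = sym (trans (cong (_+ 0#) (zeroʳ _)) (+-identityʳ 0#))
  eval-÷ (c ∷ [])     a x = solve 4 (λ c x a z → c :+ x :* z := (x :- a) :* z :+ (c :+ a :* z)) refl c x a 0#
  eval-÷ (c ∷ d ∷ ds) a x = begin
    c + x * eval g x                 ≡⟨ cong (λ t → c + x * t) (eval-÷ (d ∷ ds) a x) ⟩
    c + x * ((x - a) * q + e)        ≡⟨ solve 5 (λ c x a q e → c :+ x :* ((x :- a) :* q :+ e)
                                                     := (x :- a) :* (e :+ x :* q) :+ (c :+ a :* e)) refl c x a q e ⟩
    (x - a) * (e + x * q) + (c + a * e) ∎
    where
    g = d ∷ ds
    q = eval (g ÷[X- a ]) x
    e = eval g a

  length-÷ : ∀ c cs a → suc (length ((c ∷ cs) ÷[X- a ])) ≡ length (c ∷ cs)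
  length-÷ c []       a = refl
  length-÷ c (d ∷ ds) a = cong suc (length-÷ d ds a)

  c+a*0≡c : ∀ c a → c + a * 0# ≡ c
  c+a*0≡c c a = trans (cong (c +_) (zeroʳ a)) (+-identityʳ c)

  ÷-allZero : ∀ f a → eval f a ≡ 0# → All (_≡ 0#) (f ÷[X- a ]) → All (_≡ 0#) f
  ÷-allZero []           a _    _           = []
  ÷-allZero (c ∷ [])     a fa≡0 _           = trans (sym (c+a*0≡c c a)) fa≡0 ∷ []
  ÷-allZero (c ∷ d ∷ ds) a fa≡0 (ga≡0 ∷ qs) =
    trans (sym (c+a*0≡c c a)) (trans (cong (λ t → c + a * t) (sym ga≡0)) fa≡0) ∷ ÷-allZero (d ∷ ds) a ga≡0 qs

  ÷-preserves-roots : ∀ {f a x} → eval f a ≡ 0# → a ≢ x → eval f x ≡ 0# → eval (f ÷[X- a ]) x ≡ 0#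
  ÷-preserves-roots {f} {a} {x} fa≡0 a≢x fx≡0 with x*y≡0⇒x≡0⊎y≡0 (begin
    (x - a) * eval (f ÷[X- a ]) x              ≡⟨ +-identityʳ _ ⟨
    (x - a) * eval (f ÷[X- a ]) x + 0#         ≡⟨ cong ((x - a) * eval (f ÷[X- a ]) x +_) fa≡0 ⟨
    (x - a) * eval (f ÷[X- a ]) x + eval f a   ≡⟨ eval-÷ f a x ⟨
    eval f x                                   ≡⟨ fx≡0 ⟩
    0#                                         ∎)
  ... | inj₁ x-a≡0 = contradiction x-a≡0 (x≢y⇒x-y≢0 (a≢x ∘ sym))
  ... | inj₂ q≡0   = q≡0

  root-bound : ∀ f {xs} → Unique xs → All (λ x → eval f x ≡ 0#) xs → ¬ All (_≡ 0#) f → length xs < length f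
  root-bound []                  _             _              f≢0 = contradiction [] f≢0
  root-bound (c ∷ cs) {[]}       _             _              _   = s≤s z≤n
  root-bound (c ∷ cs) {a ∷ xs}   (a∉xs ∷ xs!)  (fa≡0 ∷ fxs≡0)  f≢0 =
    subst (length (a ∷ xs) <_) (length-÷ c cs a) (s≤s (root-bound ((c ∷ cs) ÷[X- a ]) xs!
      (All.zipWith (λ (a≢x , fx≡0) → ÷-preserves-roots {c ∷ cs} fa≡0 a≢x fx≡0) (a∉xs , fxs≡0))
      (f≢0 ∘ ÷-allZero (c ∷ cs) a fa≡0)))

  X^ : ℕ → List (Fin Q)
  X^ zero    = 1# ∷ []
  X^ (suc j) = 0# ∷ X^ j

  eval-X^ : ∀ j x → eval (X^ j) x ≡ x ^ j
  eval-X^ zero    x = c+a*0≡c 1# x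
  eval-X^ (suc j) x = trans (+-identityˡ _) (cong (x *_) (eval-X^ j x))

  length-X^ : ∀ j → length (X^ j) ≡ suc j
  length-X^ zero    = refl
  length-X^ (suc j) = cong suc (length-X^ j)

  ∃-non-square : ∀ {m} → Q ≡ suc (2 ℕ.* m) → 0 < m → ∃[ ν ] (ν ≢ 0# × ν ^ m ≢ 1#)
  ∃-non-square {m@(suc j)} Q≡1+2m 0<m
    with ¬∀⟶∃¬ Q (λ x → x ≡ 0# ⊎ x ^ m ≡ 1#) (λ x → x ≟ 0# ⊎-dec x ^ m ≟ 1#) ¬all-roots
    where
    f : List (Fin Q)
    f = 0# ∷ - 1# ∷ X^ j  -- X ^ (m + 1) - X
    eval-f : ∀ x → eval f x ≡ x * (- 1# + x ^ m)
    eval-f x = trans (+-identityˡ _) (cong (λ t → x * (- 1# + x * t)) (eval-X^ j x))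
    root : ∀ {x} → x ≡ 0# ⊎ x ^ m ≡ 1# → eval f x ≡ 0#
    root {x} (inj₁ x≡0)   = trans (eval-f x) (trans (cong (_* (- 1# + x ^ m)) x≡0) (zeroˡ _))
    root {x} (inj₂ x^m≡1) = begin
      eval f x           ≡⟨ eval-f x ⟩
      x * (- 1# + x ^ m) ≡⟨ cong (λ t → x * (- 1# + t)) x^m≡1 ⟩
      x * (- 1# + 1#)    ≡⟨ cong (x *_) (-‿inverseˡ 1#) ⟩
      x * 0#             ≡⟨ zeroʳ x ⟩
      0#                 ∎
    ¬all-roots : ¬ (∀ x → x ≡ 0# ⊎ x ^ m ≡ 1#)
    ¬all-roots all-roots = <⇒≱ Q<2+m (subst (2 ℕ.+ m ℕ.≤_) (sym Q≡1+2m) (Arithmetic.2+m≤1+2m 0<m))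
      where
      Q<2+m : Q < 2 ℕ.+ m
      Q<2+m = subst₂ _<_ (length-tabulate id) (cong (2 ℕ.+_) (length-X^ j))
        (root-bound f (allFin⁺ Q) (All.tabulate (λ {x} _ → root (all-roots x)))
          λ { (_ ∷ -1≡0 ∷ _) → -x≢0 1≢0 -1≡0 })
  ... | ν , ν∉roots = ν , ν∉roots ∘ inj₁ , ν∉roots ∘ inj₂

module Blocks {Q : ℕ} (F : FieldOnFin Q) where

  open import Data.Nat as ℕ using (_<_)
  open import Data.Bool using (Bool; _∧_; if_then_else_)
  open import Data.Bool.Properties using (T-≡; T-∧) renaming (_≟_ to _≟B_)
  open import Data.Bool.ListAction using (any)
  open import Data.Fin using (Fin; zero; suc)
  open import Data.Fin.Properties using (_≟_; suc-injective)
  open import Data.Fin.Subset using (Subset; inside; _∈_; _⊆_; ∣_∣; ⁅_⁆; _∪_)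
  open import Data.Fin.Subset.Properties
    using (_⊆?_; x∈⁅x⁆; x∈p∪q⁺; ∪-identityˡ; ∪-identityʳ; ∣⁅x⁆∣≡1)
  open import Data.List using (List; _∷_; length; filter; map; concatMap; allFin)
  open import Data.List.Membership.Propositional using () renaming (_∈_ to _∈ₗ_)
  open import Data.List.Membership.Propositional.Properties using (∈-filter⁻; ∈-map⁻; ∈-deduplicate⁻)
  open import Data.List.Relation.Unary.Any using (here; satisfied)
  open import Data.List.Relation.Unary.Any.Properties using (any⁻)
  open import Data.Vec using (_∷_; here; there; lookup)
  open import Data.Vec.Properties using (lookup∘tabulate; []=⇒lookup; lookup⇒[]=; ≡-dec)
  open import Data.Product using (_×_; _,_; ∃-syntax; proj₂)
  open import Data.Sum using (inj₁; inj₂)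
  open import Function using (_∘_; Equivalence)
  open import Relation.Nullary using (¬_; Dec; yes; no; contradiction)
  open import Relation.Nullary.Decidable using (⌊_⌋; toWitness)
  open import Relation.Binary.PropositionalEquality
  open Equivalence using (to; from)
  open FiniteField F
  open IntegerCoefficients commutativeRing using (solve; _:=_; _:+_; _:*_; _:-_)
  open ≡-Reasoning

  ∈-image⁻ : ∀ {f X y} → y ∈ image F f X → ∃[ x ] (x ∈ X × f x ≡ y)
  ∈-image⁻ {f} {X} {y} y∈fX
    with satisfied (any⁻ (hit y) (allFin (ℕ.suc Q))
                     (from T-≡ (trans (sym (lookup∘tabulate hits y)) ([]=⇒lookup y∈fX))))
    where
    hit : Point F → Point F → Bool
    hit y′ x = lookup X x ∧ ⌊ f x ≟ y′ ⌋
    hits : Point F → Bool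
    hits y′ = any (hit y′) (allFin (ℕ.suc Q))
  ... | x , hit with to T-∧ hit
  ...   | x∈X , fx≡y = x , lookup⇒[]= x X (to T-≡ x∈X) , toWitness {a? = f x ≟ y} fx≡y

  ∈-act-image⁻ : ∀ {g B y} → y ∈ image F (act F g) (embed F B) → ∃[ b ] (b ∈ B × act F g (suc b) ≡ y)
  ∈-act-image⁻ {B = B} y∈gB with ∈-image⁻ {X = embed F B} y∈gB
  ... | zero  , ()         , _
  ... | suc b , there b∈B , gb≡y = b , b∈B , gb≡y

  nonempty⇒∈ : ∀ {A : Set} {xs : List A} → 0 < length xs → ∃[ x ] x ∈ₗ xs
  nonempty⇒∈ {xs = x ∷ _} _ = x , here refl

  -- the list that SL2 filters, named so that ∈-filter⁻ can be applied to SL2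
  matrices : List (Mat F)
  matrices = concatMap (λ a → concatMap (λ b → concatMap (λ c →
               map (λ d → (a , b , c , d)) (allFin Q)) (allFin Q)) (allFin Q)) (allFin Q)

  block-through : ∀ {B T} → 0 < blocksThrough F B T →
                  ∃[ g ] (det F g ≡ 1# × T ⊆ image F (act F g) (embed F B))
  block-through {B} {T} 0<λ with nonempty⇒∈ {xs = filter (T ⊆?_) (blocks F B)} 0<λ
  ... | X , X∈blocks-through with ∈-filter⁻ (T ⊆?_) {xs = blocks F B} X∈blocks-through
  ... | X∈blocks , T⊆X
    with ∈-map⁻ (λ g → image F (act F g) (embed F B)) (∈-deduplicate⁻ (≡-dec _≟B_) _ X∈blocks)
  ... | g , g∈SL2 , refl = g , proj₂ (∈-filter⁻ (λ g → det F g ≟ 1#) {xs = matrices} g∈SL2) , T⊆X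

  if≡zero⇒ : ∀ {n} {P : Set} (P? : Dec P) {u : Fin n} → (if ⌊ P? ⌋ then zero else suc u) ≡ zero → P
  if≡zero⇒ (yes p) _ = p

  if≡suc⇒ : ∀ {n} {P : Set} (P? : Dec P) {u v : Fin n} →
            (if ⌊ P? ⌋ then zero else suc u) ≡ suc v → ¬ P × u ≡ v
  if≡suc⇒ (no ¬p) eq = ¬p , suc-injective eq

  act-suc≡∞ : ∀ {a b c d x} → act F (a , b , c , d) (suc x) ≡ zero → c * x + d ≡ 0#
  act-suc≡∞ {c = c} {d} {x} = if≡zero⇒ (c * x + d ≟ 0#)

  act-suc≡suc : ∀ {a b c d x y} → act F (a , b , c , d) (suc x) ≡ suc y → a * x + b ≡ y * (c * x + d)
  act-suc≡suc {a} {b} {c} {d} {x} eq with if≡suc⇒ (c * x + d ≟ 0#) eq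
  ... | w≢0 , refl = begin
    a * x + b                                           ≡⟨ *-identityʳ _ ⟨
    (a * x + b) * 1#                                    ≡⟨ cong ((a * x + b) *_) (inv-inverse _ w≢0) ⟨
    (a * x + b) * (inv (c * x + d) * (c * x + d))       ≡⟨ *-assoc _ _ _ ⟨
    (a * x + b) * inv (c * x + d) * (c * x + d)         ∎

  -- (a b ; c d) ∈ SL(2) maps b₁, b₂, b₃ to ∞, 0, ν
  cross-ratio : ∀ {a b c d b₁ b₂ b₃ ν} → a * d - b * c ≡ 1# →
                c * b₁ + d ≡ 0# → a * b₂ + b ≡ 0# → a * b₃ + b ≡ ν * (c * b₃ + d) →
                ν * (c * c) * ((b₃ - b₁) * (b₂ - b₁)) ≡ b₃ - b₂
  cross-ratio {a} {b} {c} {d} {b₁} {b₂} {b₃} {ν} det≡1 gb₁≡∞ gb₂≡0 gb₃≡ν = begin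
    ν * (c * c) * ((b₃ - b₁) * (b₂ - b₁))  ≡⟨ solve 5 (λ ν c b₁ b₂ b₃ → ν :* (c :* c) :* ((b₃ :- b₁) :* (b₂ :- b₁))
                                                := ν :* (c :* (b₃ :- b₁)) :* (c :* (b₂ :- b₁))) refl ν c b₁ b₂ b₃ ⟩
    ν * (c * (b₃ - b₁)) * (c * (b₂ - b₁))  ≡⟨ cong₂ (λ u v → ν * u * v) (shift gb₁≡∞) (shift gb₁≡∞) ⟨
    ν * (c * b₃ + d) * (c * b₂ + d)        ≡⟨ cong (_* (c * b₂ + d)) gb₃≡ν ⟨
    (a * b₃ + b) * (c * b₂ + d)            ≡⟨ cong (_* (c * b₂ + d)) (shift gb₂≡0) ⟩
    a * (b₃ - b₂) * (c * b₂ + d)           ≡⟨ solve 6 (λ a b c d b₂ b₃ → a :* (b₃ :- b₂) :* (c :* b₂ :+ d)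
                                                := (b₃ :- b₂) :* ((a :* d :- b :* c) :+ c :* (a :* b₂ :+ b))) refl a b c d b₂ b₃ ⟩
    (b₃ - b₂) * ((a * d - b * c) + c * (a * b₂ + b))  ≡⟨ cong₂ (λ u v → (b₃ - b₂) * (u + c * v)) det≡1 gb₂≡0 ⟩
    (b₃ - b₂) * (1# + c * 0#)              ≡⟨ cong (λ t → (b₃ - b₂) * (1# + t)) (zeroʳ c) ⟩
    (b₃ - b₂) * (1# + 0#)                  ≡⟨ cong ((b₃ - b₂) *_) (+-identityʳ 1#) ⟩
    (b₃ - b₂) * 1#                         ≡⟨ *-identityʳ _ ⟩
    b₃ - b₂                                ∎
    where
    shift : ∀ {u v y x} → u * y + v ≡ 0# → u * x + v ≡ u * (x - y)
    shift {u} {v} {y} {x} uy+v≡0 = begin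
      u * x + v                  ≡⟨ solve 4 (λ u v y x → u :* x :+ v := u :* (x :- y) :+ (u :* y :+ v)) refl u v y x ⟩
      u * (x - y) + (u * y + v)  ≡⟨ cong (u * (x - y) +_) uy+v≡0 ⟩
      u * (x - y) + 0#           ≡⟨ +-identityʳ _ ⟩
      u * (x - y)                ∎

  ∣⁅x⁆∪⁅y⁆∣≡2 : ∀ {n} {x y : Fin n} → x ≢ y → ∣ ⁅ x ⁆ ∪ ⁅ y ⁆ ∣ ≡ 2
  ∣⁅x⁆∪⁅y⁆∣≡2 {x = zero}  {zero}  x≢y = contradiction refl x≢y
  ∣⁅x⁆∪⁅y⁆∣≡2 {x = zero}  {suc y} _   = cong ℕ.suc (trans (cong ∣_∣ (∪-identityˡ ⁅ y ⁆)) (∣⁅x⁆∣≡1 y))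
  ∣⁅x⁆∪⁅y⁆∣≡2 {x = suc x} {zero}  _   = cong ℕ.suc (trans (cong ∣_∣ (∪-identityʳ ⁅ x ⁆)) (∣⁅x⁆∣≡1 x))
  ∣⁅x⁆∪⁅y⁆∣≡2 {x = suc x} {suc y} x≢y = ∣⁅x⁆∪⁅y⁆∣≡2 (x≢y ∘ cong suc)

  ⁅∞,0,_⁆ : Fin Q → Subset (ℕ.suc Q)
  ⁅∞,0, ν ⁆ = inside ∷ (⁅ 0# ⁆ ∪ ⁅ ν ⁆)

  ∣⁅∞,0,ν⁆∣≡3 : ∀ {ν} → ν ≢ 0# → ∣ ⁅∞,0, ν ⁆ ∣ ≡ 3
  ∣⁅∞,0,ν⁆∣≡3 ν≢0 = cong ℕ.suc (∣⁅x⁆∪⁅y⁆∣≡2 (ν≢0 ∘ sym))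

  ¬Gives3Design-of-power-map : ∀ (B : Subset Q) m →
    (∀ {c} → c ≢ 0# → (c * c) ^ m ≡ 1#) →
    (∀ {x y} → x ∈ B → y ∈ B → x ≢ y → (x - y) ^ m ≡ 1#) →
    ∀ {ν} → ν ≢ 0# → ν ^ m ≢ 1# → ¬ Gives3Design F B
  ¬Gives3Design-of-power-map B m squares differences {ν} ν≢0 ν^m≢1 (_ , 0<λ , λ-through)
    with block-through (subst (0 <_) (sym (λ-through ⁅∞,0, ν ⁆ (∣⁅∞,0,ν⁆∣≡3 ν≢0))) 0<λ)
  ... | g@(a , b , c , d) , det≡1 , T⊆gB
    with ∈-act-image⁻ (T⊆gB here)
       | ∈-act-image⁻ (T⊆gB (there (x∈p∪q⁺ (inj₁ (x∈⁅x⁆ 0#)))))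
       | ∈-act-image⁻ (T⊆gB (there (x∈p∪q⁺ (inj₂ (x∈⁅x⁆ ν)))))
  ... | b₁ , b₁∈B , gb₁≡∞ | b₂ , b₂∈B , gb₂≡0 | b₃ , b₃∈B , gb₃≡ν = ν^m≢1 (begin
    ν ^ m                                          ≡⟨ *-^≡1 m (squares c≢0) ⟨
    (ν * (c * c)) ^ m                              ≡⟨ *-^≡1 m (trans (*-^≡1 m D₂₁^m≡1) D₃₁^m≡1) ⟨
    (ν * (c * c) * ((b₃ - b₁) * (b₂ - b₁))) ^ m    ≡⟨ cong (_^ m) cr ⟩
    (b₃ - b₂) ^ m                                  ≡⟨ differences b₃∈B b₂∈B b₃≢b₂ ⟩
    1#                                             ∎)
    where
    distinct : ∀ {x y u v} → act F g (suc x) ≡ u → act F g (suc y) ≡ v → u ≢ v → x ≢ y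
    distinct gx≡u gy≡v u≢v refl = u≢v (trans (sym gx≡u) gy≡v)
    b₃≢b₂ : b₃ ≢ b₂
    b₃≢b₂ = distinct gb₃≡ν gb₂≡0 (ν≢0 ∘ suc-injective)
    D₃₁^m≡1 : (b₃ - b₁) ^ m ≡ 1#
    D₃₁^m≡1 = differences b₃∈B b₁∈B (distinct gb₃≡ν gb₁≡∞ λ ())
    D₂₁^m≡1 : (b₂ - b₁) ^ m ≡ 1#
    D₂₁^m≡1 = differences b₂∈B b₁∈B (distinct gb₂≡0 gb₁≡∞ λ ())
    cr : ν * (c * c) * ((b₃ - b₁) * (b₂ - b₁)) ≡ b₃ - b₂
    cr = cross-ratio det≡1 (act-suc≡∞ gb₁≡∞) (trans (act-suc≡suc gb₂≡0) (zeroˡ _)) (act-suc≡suc gb₃≡ν)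
    c≢0 : c ≢ 0#
    c≢0 c≡0 = x≢y⇒x-y≢0 b₃≢b₂ (begin
      b₃ - b₂                                      ≡⟨ cr ⟨
      ν * (c * c) * ((b₃ - b₁) * (b₂ - b₁))        ≡⟨ solve 4 (λ ν c x y → ν :* (c :* c) :* (x :* y)
                                                         := c :* (ν :* c :* (x :* y))) refl ν c (b₃ - b₁) (b₂ - b₁) ⟩
      c * (ν * c * ((b₃ - b₁) * (b₂ - b₁)))        ≡⟨ cong (_* (ν * c * ((b₃ - b₁) * (b₂ - b₁)))) c≡0 ⟩
      0# * (ν * c * ((b₃ - b₁) * (b₂ - b₁)))       ≡⟨ zeroˡ _ ⟩
      0#                                           ∎)

open import Data.Nat using (ℕ; _^_; _∸_; _≤_; _*_)
open import Data.Nat.Divisibility using (_∣_)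
open import Data.Nat.Primality using (Prime)
open import Data.Fin.Subset using (Subset)
open import Data.Product using (_×_; ∃-syntax)
open import Relation.Nullary using (¬_)
open import Relation.Binary.PropositionalEquality using (_≡_)

open import Data.Product using (_,_)
open import Data.Nat.Properties using (^-*-assoc)
open import Relation.Binary.PropositionalEquality using (refl; trans; cong)
open Arithmetic using (odd-prime-power; odd^even)

proposition3p5 :
    (q n k : ℕ) →
    (∃[ p ] ∃[ m ] (Prime p × 1 ≤ m × q ≡ p ^ m)) → ¬ (2 ∣ q) →
    1 ≤ n → 2 ∣ n →
    k ∣ q ∸ 1 → 3 ≤ k →
    (F : FieldOnFin (q ^ n)) → (B : Subset (q ^ n)) →
    IsMultSubgroupOfOrder F k B →
    ¬ Gives3Design F B
proposition3p5 q n k (p , r , p-prime , 0<r , q≡pʳ) 2∤q 0<n 2∣n k∣q∸1 _ F B B≤F×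
  with odd-prime-power p-prime 0<r q≡pʳ 2∤q
... | w , refl , 0<w =
  let m , Q≡1+2m , q∸1∣m , 0<m = odd^even 0<w 0<n 2∣n
      ν , ν≢0 , ν^m≢1          = ∃-non-square Q≡1+2m 0<m
  in ¬Gives3Design-of-power-map B m (squares-^≡1 {m} Q≡1+2m)
       (differences-in-subfield {e = r * n} {r} p-prime Q≡pʳⁿ q≡pʳ B≤F× k∣q∸1 q∸1∣m) ν≢0 ν^m≢1
  where
  open FiniteField F using (squares-^≡1; differences-in-subfield)
  open Polynomials F using (∃-non-square)
  open Blocks F using (¬Gives3Design-of-power-map)
  Q≡pʳⁿ : q ^ n ≡ p ^ (r * n)
  Q≡pʳⁿ = trans (cong (_^ n) q≡pʳ) (^-*-assoc p r n)
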